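{- Let $C$ be a non-trivial (i.e. $|C|\geq 2$) neighbour-transitive code in $K(2k+1,k)=O_{k+1}$ with minimum distance $\delta\geq 2$, and suppose that $\mathrm{Aut}(C)$ acts transitively but imprimitively on $\Omega$ with system of imprimitivity $\{B_1,\ldots,B_a\}$, where $|B_i|=b$ for each $i$ and $ab=2k+1$ with $a,b\geq 2$. For each $\alpha\subseteq\Omega$ let $\iota(\alpha)$ be the multiset $\{|\alpha\cap B_i|\mid i=1,\ldots,a\}$. Then there exist integers $a_0,a_1,b_1$ such that $\iota(\alpha)=\{b^{a_0},b_1^{a_1}\}$ for all $\alpha\in C$.
   Context: Let $k\geq 2$. The odd graph $O_{k+1}=K(2k+1,k)$ has as vertices the $k$-subsets of a $(2k+1)$-set $\Omega$, adjacent iff disjoint; its automorphism group is $\mathrm{Sym}(\Omega)$. For a code $C$ (set of vertices), with $d$ graph distance, the minimum distance $\delta$ is the least distance between distinct codewords; $C_1$ is the set of vertices not in $C$ but adjacent to some codeword; $\mathrm{Aut}(C)$ is the setwise stabiliser of $C$ in $\mathrm{Sym}(\Omega)$; $C$ is neighbour-transitive if $C_1\ne\emptyset$ and $\mathrm{Aut}(C)$ is transitive on $C$ and on $C_1$. Multiset notation: $\{c_1^{m_1},\ldots,c_s^{m_s}\}$ denotes the multiset containing $c_j$ with multiplicity $m_j$. -}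

module Defs where

open import Data.Nat using (ℕ; zero; suc; _+_; _*_; _≤_)
open import Data.Fin using (Fin; _≟_)
open import Data.Fin.Subset using (Subset; ∣_∣; _∩_; ⊥)
open import Data.Fin.Permutation using (Permutation′; _⟨$⟩ʳ_; _⟨$⟩ˡ_)
open import Data.Vec using (Vec; tabulate; lookup)
open import Data.List using (List; replicate; _++_) renaming (tabulate to listTabulate)
open import Data.List.Relation.Binary.Permutation.Propositional using (_↭_)
open import Data.Product using (_×_; Σ; ∃; _,_)
open import Relation.Nullary using (¬_; does)
open import Relation.Binary.PropositionalEquality using (_≡_; _≢_)
open import Function.Bundles using (_⇔_)

IsVertex : ∀ {n} → ℕ → Subset n → Set
IsVertex k α = ∣ α ∣ ≡ k

Adj : ∀ {n} → ℕ → Subset n → Subset n → Set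
Adj k α β = IsVertex k α × IsVertex k β × (α ∩ β ≡ ⊥)

data Walk {n : ℕ} (k : ℕ) : Subset n → Subset n → ℕ → Set where
  nil  : ∀ {α} → Walk k α α 0
  step : ∀ {α β γ m} → Adj k α β → Walk k β γ m → Walk k α γ (suc m)

MinDistAtLeast : ∀ {n} (k : ℕ) → (Subset n → Set) → ℕ → Set
MinDistAtLeast k C d =
  ∀ α β → C α → C β → α ≢ β → ∀ m → Walk k α β m → d ≤ m

C₁ : ∀ {n} (k : ℕ) → (Subset n → Set) → Subset n → Set
C₁ k C ν = IsVertex k ν × ¬ C ν × ∃ (λ α → C α × Adj k α ν)

-- image α^g = { g(i) | i ∈ α }
img : ∀ {n} → Permutation′ n → Subset n → Subset n
img g α = tabulate (λ j → lookup α (g ⟨$⟩ˡ j))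

InAut : ∀ {n} → (Subset n → Set) → Permutation′ n → Set
InAut C g = ∀ α → (C α ⇔ C (img g α))

AutTransitiveOn : ∀ {n} → (Subset n → Set) → (Subset n → Set) → Set
AutTransitiveOn C P =
  ∀ α β → P α → P β → ∃ (λ g → InAut C g × img g α ≡ β)

NeighbourTransitive : ∀ {n} (k : ℕ) → (Subset n → Set) → Set
NeighbourTransitive k C =
  ∃ (C₁ k C) × AutTransitiveOn C C × AutTransitiveOn C (C₁ k C)

NonTrivial : ∀ {n} → (Subset n → Set) → Set
NonTrivial C = ∃ (λ α → ∃ (λ β → C α × C β × α ≢ β))

AutTransitiveOnΩ : ∀ {n} → (Subset n → Set) → Set
AutTransitiveOnΩ {n} C =
  ∀ (i j : Fin n) → ∃ (λ g → InAut C g × g ⟨$⟩ʳ i ≡ j)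

block : ∀ {n a} → (Fin n → Fin a) → Fin a → Subset n
block blk x = tabulate (λ i → does (blk i ≟ x))

BlockSystem : ∀ {n} (a b : ℕ) → (Subset n → Set) → (Fin n → Fin a) → Set
BlockSystem {n} a b C blk =
  (∀ x → ∣ block blk x ∣ ≡ b) ×
  (∀ g → InAut C g → ∀ (i j : Fin n) → blk i ≡ blk j →
     blk (g ⟨$⟩ʳ i) ≡ blk (g ⟨$⟩ʳ j))

-- ι(α) as a list (multiset) [ |α ∩ B_x| | x ∈ Fin a ]
ι : ∀ {n a} → (Fin n → Fin a) → Subset n → List ℕ
ι {a = a} blk α = listTabulate {n = a} (λ x → ∣ α ∩ block blk x ∣)

ms2 : ℕ → ℕ → ℕ → ℕ → List ℕ
ms2 c₁ m₁ c₂ m₂ = replicate m₁ c₁ ++ replicate m₂ c₂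

-- For a codeword α and a point p ∉ α, the k-set ν = Ω ∖ (α ∪ {p}) is adjacent to α,
-- so δ ≥ 2 puts it in C₁.  In the block B of p we count |α ∩ B| + |ν ∩ B| + 1 = b.
-- The number of ordered pairs of points of β lying in a common block,
-- Q(β) = Σₓ |β ∩ Bₓ|², is Aut(C)-invariant, and expanding Q(Ω ∖ α) = Q(ν ∪ {p})
-- gives Q(ν) + 2|ν ∩ B| + 1.  Transitivity on C₁ makes Q(ν) independent of p, hence so
-- is |α ∩ B|: every block meeting Ω ∖ α meets α in the same number b₁ < b of points,
-- and the other blocks lie inside α.  Transitivity on C makes b₁ the same for all
-- codewords, and |α| = k then fixes the number of full blocks.
module Submission where

open import Defs
open import Data.Bool using (Bool; true; false; not; _∧_)
import Data.Bool as Bool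
open import Data.Bool.Properties using (¬-not)
open import Data.Nat using (ℕ; zero; suc; _+_; _*_; _∸_; _≤_; _<_; s≤s; z<s)
open import Data.Nat.Properties
  using (+-0-commutativeMonoid; +-*-semiring; +-identityʳ; *-identityʳ; *-distribʳ-+; +-comm; +-suc;
         +-cancelˡ-≡; +-cancelʳ-≡; *-cancelˡ-≡; *-cancelʳ-≡; m+n∸m≡n; m≤m+n; m<m+n;
         <-irrefl; <⇒≢; <⇒≤; m≤n⇒∃[o]m+o≡n)
open import Data.Nat.Tactic.RingSolver using (solve-∀)
open import Data.Fin using (Fin; zero; suc; _≟_)
open import Data.Fin.Properties using (any?)
open import Data.Fin.Permutation using (Permutation′; _⟨$⟩ʳ_; _⟨$⟩ˡ_; inverseˡ; inverseʳ; flip)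
open import Data.Fin.Subset using (Subset; ∣_∣; _∩_; ⊤; ⊥; ∁)
open import Data.Fin.Subset.Properties
  using (∩-identityˡ; ∩-identityʳ; ∩-idem; ∣⊤∣≡n; ∣⊥∣≡0; ∣∁p∣≡n∸∣p∣)
open import Data.Vec using (Vec; []; _∷_; lookup; tabulate)
open import Data.Vec.Properties
  using (lookup∘tabulate; tabulate∘lookup; tabulate-cong; lookup-map; lookup-zipWith; lookup-replicate)
open import Data.List using (List; []; _∷_; replicate; _++_; length)
import Data.List as List using (tabulate)
open import Data.List.Properties using (length-tabulate)
open import Data.List.Relation.Unary.All using (All; []; _∷_)
open import Data.List.Relation.Unary.All.Properties using (tabulate⁺)
open import Data.List.Relation.Binary.Permutation.Propositional
  using (_↭_; prep; ↭-sym; ↭-trans) renaming (refl to ↭-refl)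
open import Data.List.Relation.Binary.Permutation.Propositional.Properties using (shift)
import Data.Nat.ListAction as ListAction
open import Data.Nat.ListAction.Properties using (sum-++; sum-↭)
open import Data.Sum using (_⊎_; inj₁; inj₂; map₂)
open import Data.Product using (_×_; _,_; ∃; ∃₂; proj₁; proj₂)
open import Function.Base using (_∘_)
open import Function.Bundles using (_⇔_; mk⇔; Equivalence)
open import Relation.Nullary using (¬_; yes; no; does; contradiction)
open import Relation.Nullary.Decidable using (does-⇔; dec-true; _×-dec_)
open import Relation.Binary.PropositionalEquality
open import Algebra.Properties.CommutativeMonoid.Sum +-0-commutativeMonoid
  using (sum; sum-cong-≗; sum-replicate-zero; ∑-distrib-+; ∑-comm; sum-permute)
open import Algebra.Properties.Semiring.Sum +-*-semiring using (*-distribˡ-sum)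

𝟙 : Bool → ℕ
𝟙 true  = 1
𝟙 false = 0

𝟙-∧ : ∀ x y → 𝟙 (x ∧ y) ≡ 𝟙 x * 𝟙 y
𝟙-∧ true  y = sym (+-identityʳ (𝟙 y))
𝟙-∧ false y = refl

χ : ∀ {n} → Subset n → Fin n → ℕ
χ α i = 𝟙 (lookup α i)

δ : ∀ {n} → Fin n → Fin n → ℕ
δ p i = 𝟙 (does (i ≟ p))

sum-δ : ∀ {n} (p : Fin n) (f : Fin n → ℕ) → sum (λ i → δ p i * f i) ≡ f p
sum-δ {suc n} zero    f = trans (cong₂ _+_ (+-identityʳ (f zero)) (sum-replicate-zero n)) (+-identityʳ (f zero))
sum-δ {suc n} (suc p) f = sum-δ p (f ∘ suc)

∣p∣≡∑χ : ∀ {n} (α : Subset n) → ∣ α ∣ ≡ sum (χ α)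
∣p∣≡∑χ []          = refl
∣p∣≡∑χ (true  ∷ α) = cong suc (∣p∣≡∑χ α)
∣p∣≡∑χ (false ∷ α) = ∣p∣≡∑χ α

∣p∩q∣≡∑χχ : ∀ {n} (α β : Subset n) → ∣ α ∩ β ∣ ≡ sum (λ i → χ α i * χ β i)
∣p∩q∣≡∑χχ α β = trans (∣p∣≡∑χ (α ∩ β)) (sum-cong-≗ λ i →
  trans (cong 𝟙 (lookup-zipWith _∧_ i α β)) (𝟙-∧ (lookup α i) (lookup β i)))

lookup-≗⇒≡ : ∀ {n} {A : Set} {u v : Vec A n} → (∀ i → lookup u i ≡ lookup v i) → u ≡ v
lookup-≗⇒≡ {u = u} {v} u≗v = trans (sym (tabulate∘lookup u)) (trans (tabulate-cong u≗v) (tabulate∘lookup v))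

∣p∩q∣≡∣q∣ : ∀ {n} (α β : Subset n) → (∀ j → lookup β j ≡ true → lookup α j ≡ true) →
            ∣ α ∩ β ∣ ≡ ∣ β ∣
∣p∩q∣≡∣q∣ α β β⊆α = cong ∣_∣ (lookup-≗⇒≡ {u = α ∩ β} {β} λ j →
  trans (lookup-zipWith _∧_ j α β) (∧-absorb (lookup α j) (lookup β j) (β⊆α j)))
  where
    ∧-absorb : ∀ x y → (y ≡ true → x ≡ true) → x ∧ y ≡ y
    ∧-absorb true  y     _   = refl
    ∧-absorb false false _   = refl
    ∧-absorb false true  y⇒x = y⇒x refl

∣p∣<n⇒∃∉ : ∀ {n} (α : Subset n) → ∣ α ∣ < n → ∃ λ p → lookup α p ≡ false
∣p∣<n⇒∃∉ {n} α ∣α∣<n with any? (λ p → lookup α p Bool.≟ false)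
... | yes outside = outside
... | no  none    = contradiction ∣α∣≡n (λ eq → <-irrefl eq ∣α∣<n)
  where
    ∣α∣≡n : ∣ α ∣ ≡ n
    ∣α∣≡n = begin
      ∣ α ∣      ≡⟨ cong ∣_∣ (sym (∩-identityʳ α)) ⟩
      ∣ α ∩ ⊤ ∣  ≡⟨ ∣p∩q∣≡∣q∣ α ⊤ (λ j _ → ¬-not (λ j∉α → none (j , j∉α))) ⟩
      ∣ ⊤ {n} ∣  ≡⟨ ∣⊤∣≡n n ⟩
      n          ∎
      where open ≡-Reasoning

↭-two-valued : ∀ {A : Set} {x y : A} (L : List A) → All (λ v → v ≡ x ⊎ v ≡ y) L →
               ∃₂ λ F G → F + G ≡ length L × L ↭ replicate F x ++ replicate G y
↭-two-valued []      []                  = 0 , 0 , refl , ↭-refl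
↭-two-valued (_ ∷ L) (inj₁ refl ∷ L-two) with ↭-two-valued L L-two
... | F , G , F+G≡∣L∣ , L↭ = suc F , G , cong suc F+G≡∣L∣ , prep _ L↭
↭-two-valued {x = x} {y} (_ ∷ L) (inj₂ refl ∷ L-two) with ↭-two-valued L L-two
... | F , G , F+G≡∣L∣ , L↭ = F , suc G , trans (+-suc F G) (cong suc F+G≡∣L∣) ,
      ↭-trans (prep y L↭) (↭-sym (shift y (replicate F x) (replicate G y)))

sum-replicate : ∀ m x → ListAction.sum (replicate m x) ≡ m * x
sum-replicate zero    x = refl
sum-replicate (suc m) x = cong (x +_) (sum-replicate m x)

sum-ms2 : ∀ c m c′ m′ → ListAction.sum (ms2 c m c′ m′) ≡ m * c + m′ * c′
sum-ms2 c m c′ m′ = trans (sum-++ (replicate m c) _) (cong₂ _+_ (sum-replicate m c) (sum-replicate m′ c′))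

sum-tabulate : ∀ {n} (f : Fin n → ℕ) → ListAction.sum (List.tabulate f) ≡ sum f
sum-tabulate {zero}  f = refl
sum-tabulate {suc n} f = cong (f zero +_) (sum-tabulate (f ∘ suc))

two-value-counts-unique : ∀ {b₁ b} F G F′ G′ → b₁ < b → F + G ≡ F′ + G′ →
  F * b + G * b₁ ≡ F′ * b + G′ * b₁ → F ≡ F′ × G ≡ G′
two-value-counts-unique {b₁} {b} F G F′ G′ b₁<b same-total same-sum = F≡F′ , G≡G′
  where
    c : ℕ
    c = proj₁ (m≤n⇒∃[o]m+o≡n b₁<b)
    b≡1+b₁+c : suc b₁ + c ≡ b
    b≡1+b₁+c = proj₂ (m≤n⇒∃[o]m+o≡n b₁<b)
    regroup : ∀ H K → H * b + K * b₁ ≡ H * suc c + (H + K) * b₁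
    regroup H K = trans (cong (λ t → H * t + K * b₁) (sym b≡1+b₁+c)) (expand H K b₁ c)
      where
        expand : ∀ H K b₁ c → H * (suc b₁ + c) + K * b₁ ≡ H * suc c + (H + K) * b₁
        expand = solve-∀
    F≡F′ : F ≡ F′
    F≡F′ = *-cancelʳ-≡ F F′ (suc c) (+-cancelʳ-≡ ((F + G) * b₁) _ _ (begin
      F * suc c + (F + G) * b₁     ≡⟨ sym (regroup F G) ⟩
      F * b + G * b₁               ≡⟨ same-sum ⟩
      F′ * b + G′ * b₁             ≡⟨ regroup F′ G′ ⟩
      F′ * suc c + (F′ + G′) * b₁  ≡⟨ cong (λ t → F′ * suc c + t * b₁) (sym same-total) ⟩
      F′ * suc c + (F + G) * b₁    ∎))
      where open ≡-Reasoning
    G≡G′ : G ≡ G′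
    G≡G′ = +-cancelˡ-≡ F G G′ (trans same-total (cong (_+ G′) (sym F≡F′)))

module KernelForm {n} (E : Fin n → Fin n → ℕ) where

  apply : (Fin n → ℕ) → Fin n → ℕ
  apply f p = sum (λ j → f j * E j p)

  form : (Fin n → ℕ) → ℕ
  form f = sum (λ i → f i * apply f i)

  apply-cong : ∀ {f g : Fin n → ℕ} → (∀ i → f i ≡ g i) → ∀ p → apply f p ≡ apply g p
  apply-cong f≗g p = sum-cong-≗ λ j → cong (_* E j p) (f≗g j)

  form-cong : ∀ {f g : Fin n → ℕ} → (∀ i → f i ≡ g i) → form f ≡ form g
  form-cong f≗g = sum-cong-≗ λ i → cong₂ _*_ (f≗g i) (apply-cong f≗g i)

  apply-+ : ∀ f g p → apply (λ i → f i + g i) p ≡ apply f p + apply g p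
  apply-+ f g p = trans (sum-cong-≗ λ j → *-distribʳ-+ (E j p) (f j) (g j)) (∑-distrib-+ {n} _ _)

  apply-δ : ∀ q p → apply (δ q) p ≡ E q p
  apply-δ q p = sum-δ q (λ j → E j p)

  form-+δ : (∀ i j → E i j ≡ E j i) → ∀ f p →
            form (λ i → f i + δ p i) ≡ form f + 2 * apply f p + E p p
  form-+δ E-sym f p = begin
    form (λ i → f i + δ p i)
      ≡⟨ sum-cong-≗ (λ i → cong ((f i + δ p i) *_)
                              (trans (apply-+ f (δ p) i) (cong (apply f i +_) (apply-δ p i)))) ⟩
    sum (λ i → (f i + δ p i) * (apply f i + E p i))
      ≡⟨ sum-cong-≗ (λ i → expand (f i) (δ p i) (apply f i) (E p i)) ⟩
    sum (λ i → f i * apply f i + f i * E p i + δ p i * (apply f i + E p i))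
      ≡⟨ trans (∑-distrib-+ {n} _ _) (cong (_+ sum (λ i → δ p i * (apply f i + E p i))) (∑-distrib-+ {n} _ _)) ⟩
    form f + sum (λ i → f i * E p i) + sum (λ i → δ p i * (apply f i + E p i))
      ≡⟨ cong₂ (λ u v → form f + u + v) (sum-cong-≗ λ i → cong (f i *_) (E-sym p i)) (sum-δ p _) ⟩
    form f + apply f p + (apply f p + E p p)
      ≡⟨ collect (form f) (apply f p) (E p p) ⟩
    form f + 2 * apply f p + E p p ∎
    where
      open ≡-Reasoning
      expand : ∀ x d m e → (x + d) * (m + e) ≡ x * m + x * e + d * (m + e)
      expand = solve-∀
      collect : ∀ q m e → q + m + (m + e) ≡ q + 2 * m + e
      collect = solve-∀

  module _ (π : Permutation′ n) (E-inv : ∀ i j → E (π ⟨$⟩ʳ i) (π ⟨$⟩ʳ j) ≡ E i j)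
           {f f′ : Fin n → ℕ} (f′∘π≗f : ∀ i → f′ (π ⟨$⟩ʳ i) ≡ f i) where

    apply-invariant : ∀ p → apply f′ (π ⟨$⟩ʳ p) ≡ apply f p
    apply-invariant p = trans (sum-permute _ π) (sum-cong-≗ λ j → cong₂ _*_ (f′∘π≗f j) (E-inv j p))

    form-invariant : form f′ ≡ form f
    form-invariant = trans (sum-permute _ π) (sum-cong-≗ λ i → cong₂ _*_ (f′∘π≗f i) (apply-invariant i))

lookup-img : ∀ {n} (g : Permutation′ n) α i → lookup (img g α) (g ⟨$⟩ʳ i) ≡ lookup α i
lookup-img g α i = trans (lookup∘tabulate _ (g ⟨$⟩ʳ i)) (cong (lookup α) (inverseˡ g))

img-flip : ∀ {n} (g : Permutation′ n) α → img g (img (flip g) α) ≡ α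
img-flip g α = lookup-≗⇒≡ λ i → trans (lookup∘tabulate _ i)
  (trans (lookup∘tabulate _ (g ⟨$⟩ˡ i)) (cong (lookup α) (inverseʳ g)))

InAut-flip : ∀ {n} {C : Subset n → Set} g → InAut C g → InAut C (flip g)
InAut-flip {C = C} g g∈Aut α = mk⇔
  (λ c → from (subst C (sym (img-flip g α)) c))
  (λ c → subst C (img-flip g α) (to c))
  where open Equivalence (g∈Aut (img (flip g) α))

∁-minus : ∀ {n} → Subset n → Fin n → Subset n
∁-minus α p = tabulate (λ i → not (lookup α i) ∧ not (does (i ≟ p)))

χ+χ∁ : ∀ {n} (α : Subset n) i → χ α i + χ (∁ α) i ≡ χ ⊤ i
χ+χ∁ α i rewrite lookup-map i not α | lookup-replicate i true with lookup α i
... | true  = refl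
... | false = refl

χ∁-split : ∀ {n} (α : Subset n) p → lookup α p ≡ false →
           ∀ i → χ (∁ α) i ≡ χ (∁-minus α p) i + δ p i
χ∁-split α p p∉α i
  rewrite lookup-map i not α | lookup∘tabulate (λ i → not (lookup α i) ∧ not (does (i ≟ p))) i
  with i ≟ p
... | yes refl rewrite p∉α = refl
... | no _ with lookup α i
...   | true  = refl
...   | false = refl

∁-minus-disjoint : ∀ {n} (α : Subset n) p → α ∩ ∁-minus α p ≡ ⊥
∁-minus-disjoint α p = lookup-≗⇒≡ λ i → trans (lookup-zipWith _∧_ i α _)
  (trans (cong (lookup α i ∧_) (lookup∘tabulate _ i))
         (trans (x∧¬x∧y (lookup α i) _) (sym (lookup-replicate i false))))
  where
    x∧¬x∧y : ∀ x y → x ∧ (not x ∧ y) ≡ false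
    x∧¬x∧y true  y = refl
    x∧¬x∧y false y = refl

∣∁p∣≡∣∁-minus∣+1 : ∀ {n} (α : Subset n) p → lookup α p ≡ false →
                   ∣ ∁ α ∣ ≡ ∣ ∁-minus α p ∣ + 1
∣∁p∣≡∣∁-minus∣+1 α p p∉α = begin
  ∣ ∁ α ∣                                ≡⟨ ∣p∣≡∑χ (∁ α) ⟩
  sum (χ (∁ α))                          ≡⟨ sum-cong-≗ (χ∁-split α p p∉α) ⟩
  sum (λ i → χ (∁-minus α p) i + δ p i)  ≡⟨ ∑-distrib-+ (χ (∁-minus α p)) (δ p) ⟩
  sum (χ (∁-minus α p)) + sum (δ p)      ≡⟨ cong₂ _+_ (sym (∣p∣≡∑χ (∁-minus α p))) ∑δ≡1 ⟩
  ∣ ∁-minus α p ∣ + 1                    ∎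
  where
    open ≡-Reasoning
    ∑δ≡1 : sum (δ p) ≡ 1
    ∑δ≡1 = trans (sum-cong-≗ λ i → sym (*-identityʳ (δ p i))) (sum-δ p (λ _ → 1))

vertex-has-outside-point : ∀ {k} (α : Subset (2 * k + 1)) → IsVertex k α → ∃ λ p → lookup α p ≡ false
vertex-has-outside-point {k} α α-vertex = ∣p∣<n⇒∃∉ α (subst (_< 2 * k + 1) (sym α-vertex) k<2k+1)
  where
    suc[k+k]≡2k+1 : ∀ k → suc (k + k) ≡ 2 * k + 1
    suc[k+k]≡2k+1 = solve-∀
    k<2k+1 : k < 2 * k + 1
    k<2k+1 = subst (k <_) (suc[k+k]≡2k+1 k) (s≤s (m≤m+n k k))

module _ {k : ℕ} (α : Subset (2 * k + 1)) (p : Fin (2 * k + 1))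
         (α-vertex : IsVertex k α) (p∉α : lookup α p ≡ false) where

  ∁-minus-vertex : IsVertex k (∁-minus α p)
  ∁-minus-vertex = +-cancelʳ-≡ 1 _ _ (begin
    ∣ ∁-minus α p ∣ + 1  ≡⟨ sym (∣∁p∣≡∣∁-minus∣+1 α p p∉α) ⟩
    ∣ ∁ α ∣              ≡⟨ ∣∁p∣≡n∸∣p∣ α ⟩
    2 * k + 1 ∸ ∣ α ∣    ≡⟨ cong₂ _∸_ (2k+1≡k+[k+1] k) α-vertex ⟩
    k + (k + 1) ∸ k      ≡⟨ m+n∸m≡n k (k + 1) ⟩
    k + 1                ∎)
    where
      open ≡-Reasoning
      2k+1≡k+[k+1] : ∀ k → 2 * k + 1 ≡ k + (k + 1)
      2k+1≡k+[k+1] = solve-∀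

  ∁-minus-adjacent : Adj k α (∁-minus α p)
  ∁-minus-adjacent = α-vertex , ∁-minus-vertex , ∁-minus-disjoint α p

module Blocks {n a : ℕ} (blk : Fin n → Fin a) where

  sameBlock : Fin n → Fin n → ℕ
  sameBlock i j = 𝟙 (does (blk i ≟ blk j))

  open KernelForm sameBlock public

  meet : Subset n → Fin n → ℕ
  meet α p = apply (χ α) p

  sameBlockPairs : Subset n → ℕ
  sameBlockPairs β = form (χ β)

  sameBlock-sym : ∀ i j → sameBlock i j ≡ sameBlock j i
  sameBlock-sym i j = cong 𝟙 (does-⇔ (mk⇔ sym sym) (blk i ≟ blk j) (blk j ≟ blk i))

  sameBlock-refl : ∀ i → sameBlock i i ≡ 1
  sameBlock-refl i = cong 𝟙 (dec-true (blk i ≟ blk i) refl)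

  sameBlock-invariant : ∀ (g : Permutation′ n) →
                        (∀ i j → blk (g ⟨$⟩ʳ i) ≡ blk (g ⟨$⟩ʳ j) ⇔ blk i ≡ blk j) →
                        ∀ i j → sameBlock (g ⟨$⟩ʳ i) (g ⟨$⟩ʳ j) ≡ sameBlock i j
  sameBlock-invariant g g-preserves i j =
    cong 𝟙 (does-⇔ (g-preserves i j) (blk (g ⟨$⟩ʳ i) ≟ blk (g ⟨$⟩ʳ j)) (blk i ≟ blk j))

  χ-block : ∀ x j → χ (block blk x) j ≡ 𝟙 (does (blk j ≟ x))
  χ-block x j = cong 𝟙 (lookup∘tabulate _ j)

  lookup-block : ∀ {x j} → lookup (block blk x) j ≡ true → blk j ≡ x
  lookup-block {x} {j} j∈Bx rewrite lookup∘tabulate (λ i → does (blk i ≟ x)) j with blk j ≟ x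
  ... | yes blk[j]≡x = blk[j]≡x
  ... | no  _        = contradiction j∈Bx (λ ())

  ∣p∩block∣≡meet : ∀ α p → ∣ α ∩ block blk (blk p) ∣ ≡ meet α p
  ∣p∩block∣≡meet α p =
    trans (∣p∩q∣≡∑χχ α _) (sum-cong-≗ λ j → cong (χ α j *_) (χ-block (blk p) j))

  ∑∣p∩block∣≡∣p∣ : ∀ α → sum (λ x → ∣ α ∩ block blk x ∣) ≡ ∣ α ∣
  ∑∣p∩block∣≡∣p∣ α = begin
    sum (λ x → ∣ α ∩ block blk x ∣)
      ≡⟨ sum-cong-≗ (λ x → ∣p∩q∣≡∑χχ α (block blk x)) ⟩
    sum (λ x → sum (λ j → χ α j * χ (block blk x) j))
      ≡⟨ ∑-comm (λ x j → χ α j * χ (block blk x) j) ⟩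
    sum (λ j → sum (λ x → χ α j * χ (block blk x) j))
      ≡⟨ sum-cong-≗ (λ j → trans (sym (*-distribˡ-sum {a} (χ α j) _)) (cong (χ α j *_) (inBlock j))) ⟩
    sum (λ j → χ α j * 1)
      ≡⟨ trans (sum-cong-≗ (λ j → *-identityʳ (χ α j))) (sym (∣p∣≡∑χ α)) ⟩
    ∣ α ∣ ∎
    where
      open ≡-Reasoning
      inBlock : ∀ j → sum (λ x → χ (block blk x) j) ≡ 1
      inBlock j = trans (sum-cong-≗ {a} λ x → trans (χ-block x j)
                          (trans (cong 𝟙 (does-⇔ (mk⇔ sym sym) (blk j ≟ x) (x ≟ blk j))) (sym (*-identityʳ _))))
                        (sum-δ (blk j) (λ _ → 1))

  ι-sum : ∀ α → ListAction.sum (ι blk α) ≡ ∣ α ∣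
  ι-sum α = trans (sum-tabulate (λ x → ∣ α ∩ block blk x ∣)) (∑∣p∩block∣≡∣p∣ α)

  ∣block∣-split : ∀ α p → lookup α p ≡ false →
    ∣ block blk (blk p) ∣ ≡ meet α p + suc (meet (∁-minus α p) p)
  ∣block∣-split α p p∉α = begin
    ∣ block blk (blk p) ∣                            ≡⟨ cong ∣_∣ (sym (∩-identityˡ (block blk (blk p)))) ⟩
    ∣ ⊤ ∩ block blk (blk p) ∣                        ≡⟨ ∣p∩block∣≡meet ⊤ p ⟩
    apply (χ ⊤) p                                    ≡⟨ apply-cong χ⊤-split p ⟩
    apply (λ i → χ α i + (δ p i + χ ν i)) p          ≡⟨ apply-+ (χ α) _ p ⟩
    meet α p + apply (λ i → δ p i + χ ν i) p         ≡⟨ cong (meet α p +_) (apply-+ (δ p) (χ ν) p) ⟩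
    meet α p + (apply (δ p) p + meet ν p)
      ≡⟨ cong (λ e → meet α p + (e + meet ν p)) (trans (apply-δ p p) (sameBlock-refl p)) ⟩
    meet α p + suc (meet ν p)                        ∎
    where
      open ≡-Reasoning
      ν : Subset n
      ν = ∁-minus α p
      χ⊤-split : ∀ i → χ ⊤ i ≡ χ α i + (δ p i + χ ν i)
      χ⊤-split i = trans (sym (χ+χ∁ α i))
                         (cong (χ α i +_) (trans (χ∁-split α p p∉α i) (+-comm (χ ν i) (δ p i))))

  sameBlockPairs-∁ : ∀ α p → lookup α p ≡ false →
    sameBlockPairs (∁ α) ≡ sameBlockPairs (∁-minus α p) + 2 * meet (∁-minus α p) p + 1
  sameBlockPairs-∁ α p p∉α = trans (form-cong (χ∁-split α p p∉α))
    (trans (form-+δ sameBlock-sym (χ ν) p) (cong (sameBlockPairs ν + 2 * meet ν p +_) (sameBlock-refl p)))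
    where
      ν : Subset n
      ν = ∁-minus α p

module NeighbourTransitiveCode
  {k : ℕ} {C : Subset (2 * k + 1) → Set} (C-vertices : ∀ α → C α → IsVertex k α)
  (1≤k : 1 ≤ k) (δ≥2 : MinDistAtLeast k C 2) (C₁-trans : AutTransitiveOn C (C₁ k C))
  {a b : ℕ} {blk : Fin (2 * k + 1) → Fin a} (bs : BlockSystem a b C blk) where

  open Blocks blk

  ∁-minus∈C₁ : ∀ {α p} → C α → lookup α p ≡ false → C₁ k C (∁-minus α p)
  ∁-minus∈C₁ {α} {p} α∈C p∉α =
    ∁-minus-vertex α p α-vertex p∉α , ν∉C , α , α∈C , ∁-minus-adjacent α p α-vertex p∉α
    where
      α-vertex : IsVertex k α
      α-vertex = C-vertices α α∈C
      α≢ν : α ≢ ∁-minus α p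
      α≢ν α≡ν = <⇒≢ 1≤k (sym (trans (sym α-vertex) (trans (cong ∣_∣ α≡⊥) (∣⊥∣≡0 (2 * k + 1)))))
        where
          α≡⊥ : α ≡ ⊥
          α≡⊥ = trans (sym (∩-idem α)) (trans (cong (α ∩_) α≡ν) (∁-minus-disjoint α p))
      ν∉C : ¬ C (∁-minus α p)
      ν∉C ν∈C with δ≥2 α _ α∈C ν∈C α≢ν 1 (step (∁-minus-adjacent α p α-vertex p∉α) nil)
      ... | s≤s ()

  Aut-preserves-blocks : ∀ g → InAut C g → ∀ i j → blk (g ⟨$⟩ʳ i) ≡ blk (g ⟨$⟩ʳ j) ⇔ blk i ≡ blk j
  Aut-preserves-blocks g g∈Aut i j = mk⇔
    (λ same → subst₂ (λ u v → blk u ≡ blk v) (inverseˡ g) (inverseˡ g)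
                (proj₂ bs (flip g) (InAut-flip g g∈Aut) (g ⟨$⟩ʳ i) (g ⟨$⟩ʳ j) same))
    (proj₂ bs g g∈Aut i j)

  meet-Aut-invariant : ∀ g → InAut C g → ∀ α p → meet (img g α) (g ⟨$⟩ʳ p) ≡ meet α p
  meet-Aut-invariant g g∈Aut α =
    apply-invariant g (sameBlock-invariant g (Aut-preserves-blocks g g∈Aut)) {χ α} {χ (img g α)}
                    (λ i → cong 𝟙 (lookup-img g α i))

  sameBlockPairs-Aut-invariant : ∀ g → InAut C g → ∀ β → sameBlockPairs (img g β) ≡ sameBlockPairs β
  sameBlockPairs-Aut-invariant g g∈Aut β =
    form-invariant g (sameBlock-invariant g (Aut-preserves-blocks g g∈Aut)) {χ β} {χ (img g β)}
                   (λ i → cong 𝟙 (lookup-img g β i))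

  meet-split : ∀ α p → lookup α p ≡ false → meet α p + suc (meet (∁-minus α p) p) ≡ b
  meet-split α p p∉α = trans (sym (∣block∣-split α p p∉α)) (proj₁ bs (blk p))

  meet-constant-outside : ∀ {α p q} → C α → lookup α p ≡ false → lookup α q ≡ false → meet α p ≡ meet α q
  meet-constant-outside {α} {p} {q} α∈C p∉α q∉α = +-cancelʳ-≡ (suc (m q)) _ _ (begin
    meet α p + suc (m q)  ≡⟨ cong (λ t → meet α p + suc t) (sym mp≡mq) ⟩
    meet α p + suc (m p)  ≡⟨ meet-split α p p∉α ⟩
    b                     ≡⟨ sym (meet-split α q q∉α) ⟩
    meet α q + suc (m q)  ∎)
    where
      open ≡-Reasoning
      ν : Fin (2 * k + 1) → Subset (2 * k + 1)
      ν = ∁-minus α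
      m : Fin (2 * k + 1) → ℕ
      m r = meet (ν r) r
      same-pairs : sameBlockPairs (ν q) ≡ sameBlockPairs (ν p)
      same-pairs with C₁-trans _ _ (∁-minus∈C₁ α∈C p∉α) (∁-minus∈C₁ α∈C q∉α)
      ... | g , g∈Aut , gνp≡νq =
        trans (cong sameBlockPairs (sym gνp≡νq)) (sameBlockPairs-Aut-invariant g g∈Aut (ν p))
      mp≡mq : m p ≡ m q
      mp≡mq = *-cancelˡ-≡ (m p) (m q) 2 (+-cancelˡ-≡ (sameBlockPairs (ν q)) _ _ (+-cancelʳ-≡ 1 _ _ (begin
        sameBlockPairs (ν q) + 2 * m p + 1  ≡⟨ cong (λ t → t + 2 * m p + 1) same-pairs ⟩
        sameBlockPairs (ν p) + 2 * m p + 1  ≡⟨ sym (sameBlockPairs-∁ α p p∉α) ⟩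
        sameBlockPairs (∁ α)                ≡⟨ sameBlockPairs-∁ α q q∉α ⟩
        sameBlockPairs (ν q) + 2 * m q + 1  ∎)))

  block-count-two-valued : ∀ {α p} → C α → lookup α p ≡ false →
    ∀ x → ∣ α ∩ block blk x ∣ ≡ b ⊎ ∣ α ∩ block blk x ∣ ≡ meet α p
  block-count-two-valued {α} {p} α∈C p∉α x with any? (λ r → (blk r ≟ x) ×-dec (lookup α r Bool.≟ false))
  ... | yes (r , refl , r∉α) = inj₂ (trans (∣p∩block∣≡meet α r) (meet-constant-outside α∈C r∉α p∉α))
  ... | no  none             = inj₁ (trans (∣p∩q∣≡∣q∣ α (block blk x) Bx⊆α) (proj₁ bs x))
    where
      Bx⊆α : ∀ j → lookup (block blk x) j ≡ true → lookup α j ≡ true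
      Bx⊆α j j∈Bx = ¬-not (λ j∉α → none (j , lookup-block j∈Bx , j∉α))

  module Shape (C-trans : AutTransitiveOn C C) (α₀ : Subset (2 * k + 1)) (p₀ : Fin (2 * k + 1))
               (α₀∈C : C α₀) (p₀∉α₀ : lookup α₀ p₀ ≡ false) where

    b₁ : ℕ
    b₁ = meet α₀ p₀

    b₁<b : b₁ < b
    b₁<b = subst (b₁ <_) (meet-split α₀ p₀ p₀∉α₀) (m<m+n b₁ z<s)

    HasShape : Subset (2 * k + 1) → ℕ → ℕ → Set
    HasShape α F G = F + G ≡ a × F * b + G * b₁ ≡ k × ι blk α ↭ ms2 b F b₁ G

    ι-two-valued : ∀ {α} → C α → All (λ v → v ≡ b ⊎ v ≡ b₁) (ι blk α)
    ι-two-valued {α} α∈C with C-trans α₀ α α₀∈C α∈C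
    ... | g , g∈Aut , refl = tabulate⁺ (map₂ (λ e → trans e meet≡b₁) ∘ block-count-two-valued α∈C q∉α)
      where
        q : Fin (2 * k + 1)
        q = g ⟨$⟩ʳ p₀
        q∉α : lookup α q ≡ false
        q∉α = trans (lookup-img g α₀ p₀) p₀∉α₀
        meet≡b₁ : meet α q ≡ b₁
        meet≡b₁ = meet-Aut-invariant g g∈Aut α₀ p₀

    codeword-shape : ∀ {α} → C α → ∃₂ (HasShape α)
    codeword-shape {α} α∈C with ↭-two-valued (ι blk α) (ι-two-valued α∈C)
    ... | F , G , F+G≡∣ι∣ , ι↭ = F , G , trans F+G≡∣ι∣ (length-tabulate _) , total , ι↭
      where
        total : F * b + G * b₁ ≡ k
        total = begin
          F * b + G * b₁                 ≡⟨ sym (sum-ms2 b F b₁ G) ⟩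
          ListAction.sum (ms2 b F b₁ G)  ≡⟨ sym (sum-↭ ι↭) ⟩
          ListAction.sum (ι blk α)       ≡⟨ ι-sum α ⟩
          ∣ α ∣                          ≡⟨ C-vertices α α∈C ⟩
          k                              ∎
          where open ≡-Reasoning

    uniform-shape : ∃₂ λ F G → ∀ α → C α → ι blk α ↭ ms2 b F b₁ G
    uniform-shape with codeword-shape α₀∈C
    ... | F₀ , G₀ , F₀+G₀≡a , total₀ , _ = F₀ , G₀ , λ α α∈C → conform α (codeword-shape α∈C)
      where
        conform : ∀ α → ∃₂ (HasShape α) → ι blk α ↭ ms2 b F₀ b₁ G₀
        conform α (F , G , F+G≡a , total , ι↭)
          with two-value-counts-unique F G F₀ G₀ b₁<b (trans F+G≡a (sym F₀+G₀≡a)) (trans total (sym total₀))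
        ... | refl , refl = ι↭

lemma5p3 : (k : ℕ) → 2 ≤ k → (C : Subset (2 * k + 1) → Set) →
    (∀ α → C α → IsVertex k α) → NonTrivial C → NeighbourTransitive k C →
    MinDistAtLeast k C 2 → AutTransitiveOnΩ C →
    (a b : ℕ) → 2 ≤ a → 2 ≤ b → a * b ≡ 2 * k + 1 →
    (blk : Fin (2 * k + 1) → Fin a) → BlockSystem a b C blk →
    ∃ (λ a₀ → ∃ (λ a₁ → ∃ (λ b₁ →
      ∀ α → C α → ι blk α ↭ ms2 b a₀ b₁ a₁)))
lemma5p3 k 2≤k C C-vertices (α₀ , _ , α₀∈C , _) (_ , C-trans , C₁-trans) δ≥2 _ a b _ _ _ blk bs
  with vertex-has-outside-point α₀ (C-vertices α₀ α₀∈C)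
... | p₀ , p₀∉α₀ = let a₀ , a₁ , ι↭ = uniform-shape in a₀ , a₁ , b₁ , ι↭
  where
    open NeighbourTransitiveCode C-vertices (<⇒≤ 2≤k) δ≥2 C₁-trans bs
    open Shape C-trans α₀ p₀ α₀∈C p₀∉α₀
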